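{- Let $f$ be a real-valued function on streams that is subadditive, non-negative, bounded and monotone. Then $f$ is $2$-almost-smooth.
   Context: For disjoint consecutive segments $A,B$ of a stream, $AB$ denotes their concatenation; $n$ is a size measure of the stream. $f$ is subadditive if $f(AB)\le f(A)+f(B)$ for all disjoint segments $A,B$; non-negative if $f(A)\ge0$ always; bounded if $f(A)\le\mathrm{poly}(n)$ for every stream $A$; monotone if $f(AB)\ge f(B)$ and $f(AB)\ge f(A)$ for all disjoint segments $A,B$. A function is $d$-almost-smooth if it is $(1,d)$-almost-smooth, where $f$ is $(c,d)$-almost-smooth ($c,d\ge1$) if: (1) $f(A)\ge0$ for all streams $A$; (2) $f(B)\le c f(AB)$ for all disjoint segments $A,B$; (3) $f(A)\le\mathrm{poly}(n)$ for all $A$; (4) for all disjoint segments $A,B,C$, $\frac{f(B)}{f(AB)}\le d\cdot\frac{f(BC)}{f(ABC)}$ whenever $f(AB)\neq0$ and $f(ABC)\ne0$. -}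

module Defs where

open import Level using (Level; suc; _⊔_)
open import Data.Nat as ℕ using (ℕ)
open import Data.List using (List; _++_)
open import Data.Product using (Σ; ∃; _×_)
open import Relation.Binary.PropositionalEquality using (_≡_)
open import Relation.Nullary using (¬_)
import Data.Sum

-- An ordered field (the reals are one); the statement is made for every
-- ordered field, in particular for ℝ (which the stdlib lacks).
record OrderedField (c ℓ : Level) : Set (Level.suc (c ⊔ ℓ)) where
  infixl 6 _+_
  infixl 7 _*_
  infix 4 _≤_
  field
    Carrier : Set c
    _+_ _*_ : Carrier → Carrier → Carrier
    -_      : Carrier → Carrier
    0# 1#   : Carrier
    inv     : (x : Carrier) → ¬ (x ≡ 0#) → Carrier
    _≤_     : Carrier → Carrier → Set ℓ
    +-assoc     : ∀ x y z → (x + y) + z ≡ x + (y + z)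
    +-comm      : ∀ x y → x + y ≡ y + x
    +-identityˡ : ∀ x → 0# + x ≡ x
    +-inverseˡ  : ∀ x → (- x) + x ≡ 0#
    *-assoc     : ∀ x y z → (x * y) * z ≡ x * (y * z)
    *-comm      : ∀ x y → x * y ≡ y * x
    *-identityˡ : ∀ x → 1# * x ≡ x
    distribˡ    : ∀ x y z → x * (y + z) ≡ (x * y) + (x * z)
    0≢1         : ¬ (0# ≡ 1#)
    inv-inverse : ∀ x (x≢0 : ¬ (x ≡ 0#)) → x * inv x x≢0 ≡ 1#
    ≤-refl      : ∀ x → x ≤ x
    ≤-trans     : ∀ {x y z} → x ≤ y → y ≤ z → x ≤ z
    ≤-antisym   : ∀ {x y} → x ≤ y → y ≤ x → x ≡ y
    ≤-total     : ∀ x y → (x ≤ y) Data.Sum.⊎ (y ≤ x)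
    +-mono-≤    : ∀ {x y} z → x ≤ y → x + z ≤ y + z
    *-nonneg    : ∀ {x y} → 0# ≤ x → 0# ≤ y → 0# ≤ x * y

  fromℕ : ℕ → Carrier
  fromℕ ℕ.zero    = 0#
  fromℕ (ℕ.suc n) = 1# + fromℕ n

  2# : Carrier
  2# = 1# + 1#

module _ {c ℓ : Level} (F : OrderedField c ℓ) {X : Set} where
  open OrderedField F

  -- Streams are finite sequences over X; concatenation AB of consecutive
  -- disjoint segments is list append.  size A is the size measure n.
  Subadditive : (List X → Carrier) → Set ℓ
  Subadditive f = ∀ A B → f (A ++ B) ≤ f A + f B

  NonNegative : (List X → Carrier) → Set ℓ
  NonNegative f = ∀ A → 0# ≤ f A

  -- f(A) ≤ poly(n): a fixed polynomial bound (coefficients and degree in ℕ)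
  Bounded : (size : List X → ℕ) → (List X → Carrier) → Set ℓ
  Bounded size f = ∃ λ (a : ℕ) → ∃ λ (k : ℕ) →
    ∀ A → f A ≤ fromℕ (a ℕ.* (size A ℕ.^ k) ℕ.+ a)

  Monotone : (List X → Carrier) → Set ℓ
  Monotone f = ∀ A B → (f B ≤ f (A ++ B)) × (f A ≤ f (A ++ B))

  AlmostSmooth : (size : List X → ℕ) → Carrier → Carrier → (List X → Carrier) → Set (c ⊔ ℓ)
  AlmostSmooth size cc d f =
    NonNegative f
    × (∀ A B → f B ≤ cc * f (A ++ B))
    × Bounded size f
    × (∀ A B C → (ab≢0 : ¬ (f (A ++ B) ≡ 0#)) → (abc≢0 : ¬ (f (A ++ (B ++ C)) ≡ 0#)) →
         f B * inv (f (A ++ B)) ab≢0 ≤ d * (f (B ++ C) * inv (f (A ++ (B ++ C))) abc≢0))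

  DAlmostSmooth : (size : List X → ℕ) → Carrier → (List X → Carrier) → Set (c ⊔ ℓ)
  DAlmostSmooth size d f = AlmostSmooth size 1# d f

-- With b = f B, a = f(AB), t = f(BC), s = f(ABC): monotonicity gives b ≤ a and
-- b ≤ t, and subadditivity with monotonicity gives s ≤ f A + t ≤ a + t.  Hence
-- b s ≤ b a + b t ≤ 2 t a, and dividing by the positive a s yields b / a ≤ 2 t / s.
module Submission where

open import Defs
open import Level using (Level)
open import Data.Nat using (ℕ)
open import Data.List using (List; _++_)
open import Data.Product using (_,_; proj₁; proj₂)
open import Data.Sum using (inj₁; inj₂)
open import Relation.Nullary using (¬_; contradiction)
open import Relation.Binary.PropositionalEquality
  using (_≡_; refl; sym; trans; cong; cong₂; module ≡-Reasoning)

module OrderedFieldProperties {c ℓ : Level} (F : OrderedField c ℓ) where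
  open OrderedField F
  open ≡-Reasoning

  infixl 6 _-_
  _-_ : Carrier → Carrier → Carrier
  x - y = x + - y

  infixr 4 _≤≡_ _≡≤_
  _≤≡_ : ∀ {x y z} → x ≤ y → y ≡ z → x ≤ z
  p ≤≡ refl = p

  _≡≤_ : ∀ {x y z} → x ≡ y → y ≤ z → x ≤ z
  refl ≡≤ p = p

  +-identityʳ : ∀ x → x + 0# ≡ x
  +-identityʳ x = trans (+-comm x 0#) (+-identityˡ x)

  +-inverseʳ : ∀ x → x - x ≡ 0#
  +-inverseʳ x = trans (+-comm x (- x)) (+-inverseˡ x)

  *-identityʳ : ∀ x → x * 1# ≡ x
  *-identityʳ x = trans (*-comm x 1#) (*-identityˡ x)

  x+y-y≡x : ∀ x y → (x + y) - y ≡ x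
  x+y-y≡x x y = begin
    (x + y) - y   ≡⟨ +-assoc x y (- y) ⟩
    x + (y - y)   ≡⟨ cong (x +_) (+-inverseʳ y) ⟩
    x + 0#        ≡⟨ +-identityʳ x ⟩
    x             ∎

  x-y+y≡x : ∀ x y → (x - y) + y ≡ x
  x-y+y≡x x y = begin
    (x - y) + y   ≡⟨ +-assoc x (- y) y ⟩
    x + (- y + y) ≡⟨ cong (x +_) (+-inverseˡ y) ⟩
    x + 0#        ≡⟨ +-identityʳ x ⟩
    x             ∎

  inverse-unique : ∀ x y → x + y ≡ 0# → x ≡ - y
  inverse-unique x y e = begin
    x             ≡⟨ sym (x+y-y≡x x y) ⟩
    (x + y) - y   ≡⟨ cong (_- y) e ⟩
    0# + - y      ≡⟨ +-identityˡ (- y) ⟩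
    - y           ∎

  -‿involutive : ∀ x → - (- x) ≡ x
  -‿involutive x = sym (inverse-unique x (- x) (+-inverseʳ x))

  *-zeroʳ : ∀ x → x * 0# ≡ 0#
  *-zeroʳ x = begin
    x * 0#                 ≡⟨ sym (x+y-y≡x (x * 0#) (x * 0#)) ⟩
    (x * 0# + x * 0#) - x * 0# ≡⟨ cong (_- x * 0#) (sym (distribˡ x 0# 0#)) ⟩
    x * (0# + 0#) - x * 0# ≡⟨ cong (λ z → x * z - x * 0#) (+-identityˡ 0#) ⟩
    x * 0# - x * 0#        ≡⟨ +-inverseʳ (x * 0#) ⟩
    0#                     ∎

  *-negʳ : ∀ x y → x * (- y) ≡ - (x * y)
  *-negʳ x y = inverse-unique (x * - y) (x * y) (begin
    x * (- y) + x * y      ≡⟨ sym (distribˡ x (- y) y) ⟩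
    x * (- y + y)          ≡⟨ cong (x *_) (+-inverseˡ y) ⟩
    x * 0#                 ≡⟨ *-zeroʳ x ⟩
    0#                     ∎)

  *-distribˡ-sub : ∀ x y z → x * (y - z) ≡ x * y - x * z
  *-distribˡ-sub x y z = trans (distribˡ x y (- z)) (cong (x * y +_) (*-negʳ x z))

  x≤y⇒0≤y-x : ∀ {x y} → x ≤ y → 0# ≤ y - x
  x≤y⇒0≤y-x {x} p = sym (+-inverseʳ x) ≡≤ +-mono-≤ (- x) p

  0≤y-x⇒x≤y : ∀ {x y} → 0# ≤ y - x → x ≤ y
  0≤y-x⇒x≤y {x} {y} p = sym (+-identityˡ x) ≡≤ +-mono-≤ x p ≤≡ x-y+y≡x y x

  +-monoʳ-≤ : ∀ {x y} z → x ≤ y → z + x ≤ z + y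
  +-monoʳ-≤ {x} {y} z p = +-comm z x ≡≤ +-mono-≤ z p ≤≡ +-comm y z

  *-monoˡ-≤-nonNeg : ∀ {x y} z → 0# ≤ z → x ≤ y → z * x ≤ z * y
  *-monoˡ-≤-nonNeg {x} {y} z 0≤z p =
    0≤y-x⇒x≤y (*-nonneg 0≤z (x≤y⇒0≤y-x p) ≤≡ *-distribˡ-sub z y x)

  *-monoʳ-≤-nonNeg : ∀ {x y} z → 0# ≤ z → x ≤ y → x * z ≤ y * z
  *-monoʳ-≤-nonNeg {x} {y} z 0≤z p = *-comm x z ≡≤ *-monoˡ-≤-nonNeg z 0≤z p ≤≡ *-comm z y

  x≤0⇒0≤-x : ∀ {x} → x ≤ 0# → 0# ≤ - x
  x≤0⇒0≤-x {x} p = x≤y⇒0≤y-x p ≤≡ +-identityˡ (- x)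

  0≤-x⇒x≤0 : ∀ {x} → 0# ≤ - x → x ≤ 0#
  0≤-x⇒x≤0 {x} p = 0≤y-x⇒x≤y (p ≤≡ sym (+-identityˡ (- x)))

  0≤1 : 0# ≤ 1#
  0≤1 with ≤-total 0# 1#
  ... | inj₁ 0≤1 = 0≤1
  ... | inj₂ 1≤0 = *-nonneg 0≤-1 0≤-1 ≤≡ -1*-1≡1
    where
    0≤-1 : 0# ≤ - 1#
    0≤-1 = x≤0⇒0≤-x 1≤0
    -1*-1≡1 : (- 1#) * (- 1#) ≡ 1#
    -1*-1≡1 = begin
      (- 1#) * (- 1#)  ≡⟨ *-negʳ (- 1#) 1# ⟩
      - ((- 1#) * 1#)  ≡⟨ cong -_ (*-identityʳ (- 1#)) ⟩
      - (- 1#)         ≡⟨ -‿involutive 1# ⟩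
      1#               ∎

  inv-nonNeg : ∀ x (x≢0 : ¬ (x ≡ 0#)) → 0# ≤ x → 0# ≤ inv x x≢0
  inv-nonNeg x x≢0 0≤x with ≤-total 0# (inv x x≢0)
  ... | inj₁ 0≤x⁻¹ = 0≤x⁻¹
  ... | inj₂ x⁻¹≤0 = contradiction (≤-antisym 0≤1 1≤0) 0≢1
    where
    1≤0 : 1# ≤ 0#
    1≤0 = 0≤-x⇒x≤0 (*-nonneg 0≤x (x≤0⇒0≤-x x⁻¹≤0)
                   ≤≡ trans (*-negʳ x (inv x x≢0)) (cong -_ (inv-inverse x x≢0)))

  x*y*y⁻¹≡x : ∀ x y (y≢0 : ¬ (y ≡ 0#)) → (x * y) * inv y y≢0 ≡ x
  x*y*y⁻¹≡x x y y≢0 = trans (*-assoc x y (inv y y≢0))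
                        (trans (cong (x *_) (inv-inverse y y≢0)) (*-identityʳ x))

  cross-multiply-≤ : ∀ x y a s (a≢0 : ¬ (a ≡ 0#)) (s≢0 : ¬ (s ≡ 0#)) →
    0# ≤ a → 0# ≤ s → x * s ≤ y * a → x * inv a a≢0 ≤ y * inv s s≢0
  cross-multiply-≤ x y a s a≢0 s≢0 0≤a 0≤s xs≤ya = sym cancel-s ≡≤ scaled ≤≡ cancel-a
    where
    a⁻¹ = inv a a≢0
    s⁻¹ = inv s s≢0
    scaled : (x * s) * (a⁻¹ * s⁻¹) ≤ (y * a) * (a⁻¹ * s⁻¹)
    scaled = *-monoʳ-≤-nonNeg (a⁻¹ * s⁻¹)
               (*-nonneg (inv-nonNeg a a≢0 0≤a) (inv-nonNeg s s≢0 0≤s)) xs≤ya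
    cancel-s : (x * s) * (a⁻¹ * s⁻¹) ≡ x * a⁻¹
    cancel-s = begin
      (x * s) * (a⁻¹ * s⁻¹) ≡⟨ cong ((x * s) *_) (*-comm a⁻¹ s⁻¹) ⟩
      (x * s) * (s⁻¹ * a⁻¹) ≡⟨ sym (*-assoc (x * s) s⁻¹ a⁻¹) ⟩
      ((x * s) * s⁻¹) * a⁻¹ ≡⟨ cong (_* a⁻¹) (x*y*y⁻¹≡x x s s≢0) ⟩
      x * a⁻¹               ∎
    cancel-a : (y * a) * (a⁻¹ * s⁻¹) ≡ y * s⁻¹
    cancel-a = begin
      (y * a) * (a⁻¹ * s⁻¹) ≡⟨ sym (*-assoc (y * a) a⁻¹ s⁻¹) ⟩
      ((y * a) * a⁻¹) * s⁻¹ ≡⟨ cong (_* s⁻¹) (x*y*y⁻¹≡x y a a≢0) ⟩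
      y * s⁻¹               ∎

  x+x≡2x : ∀ x → x + x ≡ 2# * x
  x+x≡2x x = begin
    x + x             ≡⟨ sym (cong₂ _+_ (*-identityʳ x) (*-identityʳ x)) ⟩
    x * 1# + x * 1#   ≡⟨ sym (distribˡ x 1# 1#) ⟩
    x * 2#            ≡⟨ *-comm x 2# ⟩
    2# * x            ∎

  product-≤-twice : ∀ {a b s t} → 0# ≤ a → 0# ≤ b → 0# ≤ t →
    b ≤ a → b ≤ t → s ≤ a + t → b * s ≤ (2# * t) * a
  product-≤-twice {a} {b} {s} {t} 0≤a 0≤b 0≤t b≤a b≤t s≤a+t =
    ≤-trans (*-monoˡ-≤-nonNeg b 0≤b s≤a+t)
      (distribˡ b a t ≡≤ ≤-trans (+-mono-≤ (b * t) ba≤ta) (+-monoʳ-≤ (t * a) bt≤ta)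
       ≤≡ trans (x+x≡2x (t * a)) (sym (*-assoc 2# t a)))
    where
    ba≤ta : b * a ≤ t * a
    ba≤ta = *-monoʳ-≤-nonNeg a 0≤a b≤t
    bt≤ta : b * t ≤ t * a
    bt≤ta = *-comm b t ≡≤ *-monoˡ-≤-nonNeg t 0≤t b≤a

lemma2p4 : {c ℓ : Level} (F : OrderedField c ℓ) {X : Set} (size : List X → ℕ)
    (f : List X → OrderedField.Carrier F) →
    Subadditive F f → NonNegative F f → Bounded F size f → Monotone F f →
    DAlmostSmooth F size (OrderedField.2# F) f
lemma2p4 F size f subadd nonneg bounded mono =
  nonneg , suffix-≤ , bounded , ratio-≤
  where
  open OrderedField F
  open OrderedFieldProperties F

  suffix-≤ : ∀ A B → f B ≤ 1# * f (A ++ B)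
  suffix-≤ A B = proj₁ (mono A B) ≤≡ sym (*-identityˡ _)

  ratio-≤ : ∀ A B C (ab≢0 : ¬ (f (A ++ B) ≡ 0#)) (abc≢0 : ¬ (f (A ++ (B ++ C)) ≡ 0#)) →
    f B * inv (f (A ++ B)) ab≢0 ≤ 2# * (f (B ++ C) * inv (f (A ++ (B ++ C))) abc≢0)
  ratio-≤ A B C ab≢0 abc≢0 =
    cross-multiply-≤ (f B) (2# * f (B ++ C)) _ _ ab≢0 abc≢0 (nonneg _) (nonneg _)
      (product-≤-twice (nonneg _) (nonneg _) (nonneg _)
        (proj₁ (mono A B)) (proj₂ (mono B C))
        (≤-trans (subadd A (B ++ C)) (+-mono-≤ (f (B ++ C)) (proj₂ (mono A B)))))
    ≤≡ *-assoc 2# (f (B ++ C)) _
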